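{- Let $M$ be a matroid of rank $r$ on a finite set $E$ with rank function $r(\cdot)$. Then \[\gamma(M)=\sum_{I\subseteq E}(-1)^{r-|I|}\binom{r-r(I)+1}{2}.\]
   Context: The Tutte polynomial of $M$ is $T_M(x,y)=\sum_{A\subseteq E}(x-1)^{r(E)-r(A)}(y-1)^{|A|-r(A)}=\sum_{i,j}b_{ij}x^iy^j$. The gamma invariant is $\gamma(M)=b_{20}-b_{10}$. -}

module Defs where

open import Data.Nat using (ℕ; zero; suc; _≤_; _∸_)
open import Data.Nat.Combinatorics using (_C_)
open import Data.Bool using (Bool; true; false)
open import Data.Integer using (ℤ; +_; -_; 0ℤ; 1ℤ; -1ℤ) renaming (_+_ to _+ℤ_; _*_ to _*ℤ_)
open import Data.List using (List; []; _∷_)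
open import Data.Vec using (_∷_)
open import Data.Fin.Subset using (Subset; ⊤; _⊆_; _∪_; _∩_; ∣_∣)
open import Data.Nat.Base using (_+_)

record Matroid (n : ℕ) : Set where
  field
    rank         : Subset n → ℕ
    rank-bounded : ∀ A → rank A ≤ ∣ A ∣
    rank-mono    : ∀ A B → A ⊆ B → rank A ≤ rank B
    rank-submod  : ∀ A B → rank (A ∪ B) + rank (A ∩ B) ≤ rank A + rank B

open Matroid public

matroidRank : ∀ {n} → Matroid n → ℕ
matroidRank M = rank M ⊤

sumSubsets : ∀ {n} → (Subset n → ℤ) → ℤ
sumSubsets {zero}  f = f Data.Vec.[]
sumSubsets {suc n} f = sumSubsets (λ A → f (false ∷ A)) +ℤ sumSubsets (λ A → f (true ∷ A))

-- Univariate integer polynomials as coefficient lists (constant term first).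
Poly : Set
Poly = List ℤ

_+P_ : Poly → Poly → Poly
[] +P q = q
(a ∷ p) +P [] = a ∷ p
(a ∷ p) +P (b ∷ q) = (a +ℤ b) ∷ (p +P q)

scaleP : ℤ → Poly → Poly
scaleP c [] = []
scaleP c (a ∷ p) = (c *ℤ a) ∷ scaleP c p

_*P_ : Poly → Poly → Poly
[] *P q = []
(a ∷ p) *P q = scaleP a q +P (0ℤ ∷ (p *P q))

_^P_ : Poly → ℕ → Poly
p ^P zero = 1ℤ ∷ []
p ^P suc k = p *P (p ^P k)

X-1 : Poly
X-1 = -1ℤ ∷ 1ℤ ∷ []

coeff : ℕ → Poly → ℤ
coeff i [] = 0ℤ
coeff zero (a ∷ p) = a
coeff (suc i) (a ∷ p) = coeff i p

-- b_ij : coefficient of x^i y^j in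
-- T_M(x,y) = Σ_A (x-1)^{r(E)-r(A)} (y-1)^{|A|-r(A)}.
-- Since each summand is a product of a polynomial in x and one in y,
-- its x^i y^j-coefficient is the product of the respective coefficients.
tutteCoeff : ∀ {n} → Matroid n → ℕ → ℕ → ℤ
tutteCoeff M i j = sumSubsets λ A →
  coeff i (X-1 ^P (rank M ⊤ ∸ rank M A)) *ℤ coeff j (X-1 ^P (∣ A ∣ ∸ rank M A))

gamma : ∀ {n} → Matroid n → ℤ
gamma M = tutteCoeff M 2 0 +ℤ (- tutteCoeff M 1 0)

signPow : ℕ → ℤ
signPow zero = 1ℤ
signPow (suc k) = - signPow k

-- Write m_A = r − r(A) and c_A = |A| − r(A).  Every summand of the Tutte
-- polynomial is a product (x−1)^{m_A} (y−1)^{c_A}, so b_{i0} is the sum over A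
-- of [x^i](x−1)^{m_A} · [y^0](y−1)^{c_A}.  The proof has three ingredients:
--   * the binomial theorem for (X−1)^m in the coefficient-list model,
--     [X^k](X−1)^m = (−1)^{m+k} C(m,k), proved via the recurrence for
--     multiplication by X−1 and Pascal's rule;
--   * consequently [X^2](X−1)^m − [X^1](X−1)^m = (−1)^m C(m+1,2) and
--     [Y^0](Y−1)^c = (−1)^c;
--   * (−1)^{(r−x)+(c−x)} = (−1)^{r+c} whenever x ≤ r and x ≤ c, applied with
--     x = r(A), which is bounded by both r and |A| by the rank axioms.
-- Linearity of the sum over subsets then reduces γ(M) = b_20 − b_10 to the
-- equality of the summands, which is the lemma γ-summand below.
module Submission where

open import Defs
open import Data.Nat using (ℕ; zero; suc; _∸_; _+_; _≤_)
open import Data.Nat.Combinatorics using (_C_; nCk+nC[k+1]≡[n+1]C[k+1])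
open import Data.Integer using (ℤ; +_; -_; 0ℤ; 1ℤ; -1ℤ) renaming (_*_ to _*ℤ_; _+_ to _+ℤ_)
import Data.Integer.Properties as ℤP
import Data.Nat.Properties as ℕP
open import Data.Integer.Solver using (module +-*-Solver)
open +-*-Solver using (solve; _:+_; _:*_; :-_; _:=_)
open import Data.Vec using (_∷_)
open import Data.Bool using (Bool; true; false)
open import Data.List using ([]; _∷_)
open import Data.Fin.Subset using (Subset; ⊤; ∣_∣)
open import Data.Fin.Subset.Properties using (⊆⊤)
open import Relation.Binary.PropositionalEquality
open ≡-Reasoning
open import Algebra.Properties.CommutativeSemigroup ℕP.+-commutativeSemigroup
  using () renaming (interchange to ℕ-interchange)
open import Algebra.Properties.CommutativeSemigroup ℤP.+-commutativeSemigroup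
  using () renaming (interchange to ℤ-interchange)

coeff-+P : ∀ i p q → coeff i (p +P q) ≡ coeff i p +ℤ coeff i q
coeff-+P i       []      q       = sym (ℤP.+-identityˡ _)
coeff-+P i       (a ∷ p) []      = sym (ℤP.+-identityʳ _)
coeff-+P zero    (a ∷ p) (b ∷ q) = refl
coeff-+P (suc i) (a ∷ p) (b ∷ q) = coeff-+P i p q

coeff-scaleP : ∀ c i p → coeff i (scaleP c p) ≡ c *ℤ coeff i p
coeff-scaleP c i       []      = sym (ℤP.*-zeroʳ c)
coeff-scaleP c zero    (a ∷ p) = refl
coeff-scaleP c (suc i) (a ∷ p) = coeff-scaleP c i p

coeff-one-*P : ∀ i p → coeff i ((1ℤ ∷ []) *P p) ≡ coeff i p
coeff-one-*P i p = begin
  coeff i (scaleP 1ℤ p +P (0ℤ ∷ []))         ≡⟨ coeff-+P i (scaleP 1ℤ p) (0ℤ ∷ []) ⟩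
  coeff i (scaleP 1ℤ p) +ℤ coeff i (0ℤ ∷ []) ≡⟨ cong₂ _+ℤ_ (coeff-scaleP 1ℤ i p) (coeff-zero i) ⟩
  1ℤ *ℤ coeff i p +ℤ 0ℤ                      ≡⟨ ℤP.+-identityʳ _ ⟩
  1ℤ *ℤ coeff i p                            ≡⟨ ℤP.*-identityˡ _ ⟩
  coeff i p                                  ∎
  where
  coeff-zero : ∀ i → coeff i (0ℤ ∷ []) ≡ 0ℤ
  coeff-zero zero    = refl
  coeff-zero (suc i) = refl

coeff0-X-1*P : ∀ p → coeff 0 (X-1 *P p) ≡ - coeff 0 p
coeff0-X-1*P p = begin
  coeff 0 (scaleP -1ℤ p +P (0ℤ ∷ _)) ≡⟨ coeff-+P 0 (scaleP -1ℤ p) _ ⟩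
  coeff 0 (scaleP -1ℤ p) +ℤ 0ℤ       ≡⟨ ℤP.+-identityʳ _ ⟩
  coeff 0 (scaleP -1ℤ p)             ≡⟨ coeff-scaleP -1ℤ 0 p ⟩
  -1ℤ *ℤ coeff 0 p                   ≡⟨ ℤP.-1*i≡-i _ ⟩
  - coeff 0 p                        ∎

coeffSuc-X-1*P : ∀ i p → coeff (suc i) (X-1 *P p) ≡ - coeff (suc i) p +ℤ coeff i p
coeffSuc-X-1*P i p = begin
  coeff (suc i) (scaleP -1ℤ p +P (0ℤ ∷ (1ℤ ∷ []) *P p))
    ≡⟨ coeff-+P (suc i) (scaleP -1ℤ p) _ ⟩
  coeff (suc i) (scaleP -1ℤ p) +ℤ coeff i ((1ℤ ∷ []) *P p)
    ≡⟨ cong₂ _+ℤ_ (coeff-scaleP -1ℤ (suc i) p) (coeff-one-*P i p) ⟩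
  -1ℤ *ℤ coeff (suc i) p +ℤ coeff i p
    ≡⟨ cong (_+ℤ coeff i p) (ℤP.-1*i≡-i (coeff (suc i) p)) ⟩
  - coeff (suc i) p +ℤ coeff i p
    ∎

signPow-+ : ∀ a b → signPow (a + b) ≡ signPow a *ℤ signPow b
signPow-+ zero    b = sym (ℤP.*-identityˡ _)
signPow-+ (suc a) b = trans (cong -_ (signPow-+ a b)) (ℤP.neg-distribˡ-* (signPow a) (signPow b))

signPow-suc-suc : ∀ a → signPow (suc (suc a)) ≡ signPow a
signPow-suc-suc a = ℤP.neg-involutive (signPow a)

signPow-double : ∀ x → signPow (x + x) ≡ 1ℤ
signPow-double zero    = refl
signPow-double (suc x) = begin
  signPow (suc (x + suc x))   ≡⟨ cong (λ n → signPow (suc n)) (ℕP.+-suc x x) ⟩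
  signPow (suc (suc (x + x))) ≡⟨ signPow-suc-suc (x + x) ⟩
  signPow (x + x)             ≡⟨ signPow-double x ⟩
  1ℤ                          ∎

signPow-∸-∸ : ∀ {a b x} → x ≤ a → x ≤ b → signPow ((a ∸ x) + (b ∸ x)) ≡ signPow (a + b)
signPow-∸-∸ {a} {b} {x} x≤a x≤b = begin
  signPow (m + k)                       ≡⟨ ℤP.*-identityʳ _ ⟨
  signPow (m + k) *ℤ 1ℤ                 ≡⟨ cong (signPow (m + k) *ℤ_) (signPow-double x) ⟨
  signPow (m + k) *ℤ signPow (x + x)    ≡⟨ signPow-+ (m + k) (x + x) ⟨
  signPow ((m + k) + (x + x))           ≡⟨ cong signPow (ℕ-interchange m k x x) ⟩
  signPow ((m + x) + (k + x))           ≡⟨ cong₂ (λ u v → signPow (u + v)) (ℕP.m∸n+n≡m x≤a) (ℕP.m∸n+n≡m x≤b) ⟩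
  signPow (a + b)                       ∎
  where
  m = a ∸ x
  k = b ∸ x

coeff-X-1^P : ∀ m k → coeff k (X-1 ^P m) ≡ signPow (m + k) *ℤ + (m C k)
coeff-X-1^P zero    zero    = refl
coeff-X-1^P zero    (suc k) = sym (ℤP.*-zeroʳ (signPow (suc k)))
coeff-X-1^P (suc m) zero    = begin
  coeff 0 (X-1 *P (X-1 ^P m))    ≡⟨ coeff0-X-1*P (X-1 ^P m) ⟩
  - coeff 0 (X-1 ^P m)           ≡⟨ cong -_ (coeff-X-1^P m 0) ⟩
  - (signPow (m + 0) *ℤ 1ℤ)      ≡⟨ ℤP.neg-distribˡ-* (signPow (m + 0)) 1ℤ ⟩
  signPow (suc m + 0) *ℤ 1ℤ      ∎
coeff-X-1^P (suc m) (suc k) = begin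
  coeff (suc k) (X-1 *P (X-1 ^P m))
    ≡⟨ coeffSuc-X-1*P k (X-1 ^P m) ⟩
  - coeff (suc k) (X-1 ^P m) +ℤ coeff k (X-1 ^P m)
    ≡⟨ cong₂ (λ u v → - u +ℤ v) (coeff-X-1^P m (suc k)) (coeff-X-1^P m k) ⟩
  - (signPow (m + suc k) *ℤ + (m C suc k)) +ℤ s *ℤ + (m C k)
    ≡⟨ cong (λ e → - (signPow e *ℤ + (m C suc k)) +ℤ s *ℤ + (m C k)) (ℕP.+-suc m k) ⟩
  - ((- s) *ℤ + (m C suc k)) +ℤ s *ℤ + (m C k)
    ≡⟨ solve 3 (λ σ c₀ c₁ → :- ((:- σ) :* c₁) :+ σ :* c₀ := σ :* (c₀ :+ c₁)) refl s (+ (m C k)) (+ (m C suc k)) ⟩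
  s *ℤ (+ (m C k) +ℤ + (m C suc k))
    ≡⟨ cong (s *ℤ_) (ℤP.pos-+ (m C k) (m C suc k)) ⟨
  s *ℤ + (m C k + m C suc k)
    ≡⟨ cong₂ _*ℤ_ (sign-shift) (cong +_ (nCk+nC[k+1]≡[n+1]C[k+1] m k)) ⟩
  signPow (suc m + suc k) *ℤ + (suc m C suc k)
    ∎
  where
  s = signPow (m + k)
  sign-shift : s ≡ signPow (suc m + suc k)
  sign-shift = sym (trans (cong (λ e → signPow (suc e)) (ℕP.+-suc m k)) (signPow-suc-suc (m + k)))

coeff0-X-1^P : ∀ c → coeff 0 (X-1 ^P c) ≡ signPow c
coeff0-X-1^P c = begin
  coeff 0 (X-1 ^P c)        ≡⟨ coeff-X-1^P c 0 ⟩
  signPow (c + 0) *ℤ 1ℤ     ≡⟨ ℤP.*-identityʳ _ ⟩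
  signPow (c + 0)           ≡⟨ cong signPow (ℕP.+-identityʳ c) ⟩
  signPow c                 ∎

coeff2-coeff1-X-1^P : ∀ m → coeff 2 (X-1 ^P m) +ℤ - coeff 1 (X-1 ^P m) ≡ signPow m *ℤ + ((m + 1) C 2)
coeff2-coeff1-X-1^P m = begin
  coeff 2 (X-1 ^P m) +ℤ - coeff 1 (X-1 ^P m)
    ≡⟨ cong₂ (λ u v → u +ℤ - v) (coeff-X-1^P m 2) (coeff-X-1^P m 1) ⟩
  signPow (m + 2) *ℤ + (m C 2) +ℤ - (signPow (m + 1) *ℤ + (m C 1))
    ≡⟨ cong₂ (λ e f → signPow e *ℤ + (m C 2) +ℤ - (signPow f *ℤ + (m C 1))) (ℕP.+-comm m 2) (ℕP.+-comm m 1) ⟩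
  signPow (2 + m) *ℤ + (m C 2) +ℤ - ((- signPow m) *ℤ + (m C 1))
    ≡⟨ cong (λ σ → σ *ℤ + (m C 2) +ℤ - ((- signPow m) *ℤ + (m C 1))) (signPow-suc-suc m) ⟩
  s *ℤ + (m C 2) +ℤ - ((- s) *ℤ + (m C 1))
    ≡⟨ solve 3 (λ σ c₁ c₂ → σ :* c₂ :+ :- ((:- σ) :* c₁) := σ :* (c₁ :+ c₂)) refl s (+ (m C 1)) (+ (m C 2)) ⟩
  s *ℤ (+ (m C 1) +ℤ + (m C 2))
    ≡⟨ cong (s *ℤ_) (ℤP.pos-+ (m C 1) (m C 2)) ⟨
  s *ℤ + (m C 1 + m C 2)
    ≡⟨ cong (λ e → s *ℤ + e) (nCk+nC[k+1]≡[n+1]C[k+1] m 1) ⟩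
  s *ℤ + (suc m C 2)
    ≡⟨ cong (λ e → s *ℤ + (e C 2)) (ℕP.+-comm 1 m) ⟩
  s *ℤ + ((m + 1) C 2)
    ∎
  where s = signPow m

γ-summand : ∀ {r c x} → x ≤ r → x ≤ c →
  coeff 2 (X-1 ^P (r ∸ x)) *ℤ coeff 0 (X-1 ^P (c ∸ x)) +ℤ - (coeff 1 (X-1 ^P (r ∸ x)) *ℤ coeff 0 (X-1 ^P (c ∸ x)))
    ≡ signPow (r + c) *ℤ + ((r ∸ x + 1) C 2)
γ-summand {r} {c} {x} x≤r x≤c = begin
  coeff 2 P *ℤ q +ℤ - (coeff 1 P *ℤ q)
    ≡⟨ solve 3 (λ a b u → a :* u :+ :- (b :* u) := (a :+ :- b) :* u) refl (coeff 2 P) (coeff 1 P) q ⟩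
  (coeff 2 P +ℤ - coeff 1 P) *ℤ q
    ≡⟨ cong₂ _*ℤ_ (coeff2-coeff1-X-1^P (r ∸ x)) (coeff0-X-1^P (c ∸ x)) ⟩
  signPow (r ∸ x) *ℤ binom *ℤ signPow (c ∸ x)
    ≡⟨ solve 3 (λ σ τ b → σ :* b :* τ := σ :* τ :* b) refl (signPow (r ∸ x)) (signPow (c ∸ x)) binom ⟩
  signPow (r ∸ x) *ℤ signPow (c ∸ x) *ℤ binom
    ≡⟨ cong (_*ℤ binom) (signPow-+ (r ∸ x) (c ∸ x)) ⟨
  signPow ((r ∸ x) + (c ∸ x)) *ℤ binom
    ≡⟨ cong (_*ℤ binom) (signPow-∸-∸ x≤r x≤c) ⟩
  signPow (r + c) *ℤ binom
    ∎
  where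
  P     = X-1 ^P (r ∸ x)
  q     = coeff 0 (X-1 ^P (c ∸ x))
  binom = + ((r ∸ x + 1) C 2)

sumSubsets-+ : ∀ {n} (f g : Subset n → ℤ) → sumSubsets f +ℤ sumSubsets g ≡ sumSubsets (λ A → f A +ℤ g A)
sumSubsets-+ {zero}  f g = refl
sumSubsets-+ {suc n} f g = begin
  (Σ f false +ℤ Σ f true) +ℤ (Σ g false +ℤ Σ g true) ≡⟨ ℤ-interchange (Σ f false) (Σ f true) (Σ g false) (Σ g true) ⟩
  (Σ f false +ℤ Σ g false) +ℤ (Σ f true +ℤ Σ g true) ≡⟨ cong₂ _+ℤ_ (sumSubsets-+ (f ∘∷ false) (g ∘∷ false)) (sumSubsets-+ (f ∘∷ true) (g ∘∷ true)) ⟩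
  sumSubsets (λ A → f A +ℤ g A)                       ∎
  where
  _∘∷_ : (Subset (suc n) → ℤ) → Bool → Subset n → ℤ
  (h ∘∷ b) A = h (b ∷ A)
  Σ : (Subset (suc n) → ℤ) → Bool → ℤ
  Σ h b = sumSubsets (h ∘∷ b)

sumSubsets-neg : ∀ {n} (f : Subset n → ℤ) → - sumSubsets f ≡ sumSubsets (λ A → - f A)
sumSubsets-neg {zero}  f = refl
sumSubsets-neg {suc n} f = trans (ℤP.neg-distrib-+ (sumSubsets (λ A → f (false ∷ A))) (sumSubsets (λ A → f (true ∷ A))))
  (cong₂ _+ℤ_ (sumSubsets-neg (λ A → f (false ∷ A))) (sumSubsets-neg (λ A → f (true ∷ A))))

sumSubsets-cong : ∀ {n} {f g : Subset n → ℤ} → (∀ A → f A ≡ g A) → sumSubsets f ≡ sumSubsets g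
sumSubsets-cong {zero}  f≗g = f≗g _
sumSubsets-cong {suc n} f≗g = cong₂ _+ℤ_ (sumSubsets-cong (λ A → f≗g (false ∷ A))) (sumSubsets-cong (λ A → f≗g (true ∷ A)))

proposition5p3 : ∀ {n} (M : Matroid n) →
    gamma M ≡ sumSubsets (λ I → signPow (matroidRank M + ∣ I ∣) *ℤ (+ ((matroidRank M ∸ rank M I + 1) C 2)))
proposition5p3 {n} M = begin
  gamma M
    ≡⟨ cong (sumSubsets (b 2) +ℤ_) (sumSubsets-neg (b 1)) ⟩
  sumSubsets (b 2) +ℤ sumSubsets (λ A → - b 1 A)
    ≡⟨ sumSubsets-+ (b 2) (λ A → - b 1 A) ⟩
  sumSubsets (λ A → b 2 A +ℤ - b 1 A)
    ≡⟨ sumSubsets-cong (λ A → γ-summand (rank-mono M A ⊤ ⊆⊤) (rank-bounded M A)) ⟩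
  sumSubsets (λ I → signPow (matroidRank M + ∣ I ∣) *ℤ (+ ((matroidRank M ∸ rank M I + 1) C 2)))
    ∎
  where
  b : ℕ → Subset n → ℤ
  b i A = coeff i (X-1 ^P (rank M ⊤ ∸ rank M A)) *ℤ coeff 0 (X-1 ^P (∣ A ∣ ∸ rank M A))
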